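{- Consider the columns $0$, $-1$, $-2$ of the extended Trithoff array as sequences indexed by the row $r=1,2,3,\dots$. (1) The wall $(T_{r,0})_{r\ge1}$ is strictly increasing, and its set of values is exactly the set of positions of the letters $a$ and $b$ in the Tribonacci word. (2) The seed $(T_{r,-1})_{r\ge1}$ is non-decreasing; it starts with $0$ (once) and then runs through all positive integers in increasing order, where each position of the letter $a$ in the Tribonacci word appears exactly twice and every other positive integer appears exactly once. (3) The pre-seed $(T_{r,-2})_{r\ge1}$ is non-decreasing; it starts with two zeros and then runs through all positive integers in increasing order, where each position of the letters $a$ or $b$ in the Tribonacci word appears exactly three times and each position of the letter $c$ appears exactly twice.
   Context: Tribonacci numbers: $T_0=0,T_1=0,T_2=1$, $T_n=T_{n-1}+T_{n-2}+T_{n-3}$ ($n\ge3$). Every $N\ge0$ has a unique canonical Tribonacci representation $N=\sum_i d_iT_{i+3}$ with $d_i\in\{0,1\}$ and no three consecutive $1$s; $\operatorname{out}(N)=\sum_i d_iT_{i+4}$. Trithoff array: $T_{r,1}$ is the $r$-th smallest positive integer whose canonical representation has $d_0=1$, $T_{r,c+1}=\operatorname{out}(T_{r,c})$ for $c\ge1$; rows are extended to the left by the Tribonacci rule $T_{r,c}=T_{r,c+3}-T_{r,c+2}-T_{r,c+1}$. Tribonacci word: $W(0)=a$, $W(1)=ab$, $W(2)=abac$, $W(n)=W(n-1)W(n-2)W(n-3)$ for $n\ge3$; the Tribonacci word is the infinite word having each $W(n)$ as a prefix ($abacabaabacababac\cdots$), positions numbered from $1$. -}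

module Defs where

open import Data.Nat using (ℕ; zero; suc; _+_; _∸_; _≤_; _<_)
open import Data.Integer as ℤ using (ℤ; +_; -[1+_])
open import Data.Bool using (Bool; true; false)
open import Data.List using (List; []; _∷_; _++_; length)
open import Data.List.Membership.Propositional using (_∈_)
open import Data.List.Relation.Unary.All using (All)
open import Data.List.Relation.Unary.Unique.Propositional using (Unique)
open import Data.Maybe using (Maybe; just; nothing)
open import Data.Product using (Σ; ∃; _×_; _,_)
open import Data.Unit using (⊤)
open import Data.Empty using (⊥)
open import Relation.Binary.PropositionalEquality using (_≡_)

trib : ℕ → ℕ
trib 0 = 0
trib 1 = 0
trib 2 = 1
trib (suc (suc (suc n))) = trib (suc (suc n)) + trib (suc n) + trib n

-- Tribonacci representations: digit lists d_0 d_1 d_2 ... (least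
-- significant first).  valueFrom k ds = Σ_i d_i T_{i+k}.

valueFrom : ℕ → List Bool → ℕ
valueFrom k [] = 0
valueFrom k (true ∷ ds) = trib k + valueFrom (suc k) ds
valueFrom k (false ∷ ds) = valueFrom (suc k) ds

NoThree : List Bool → Set
NoThree (true ∷ true ∷ true ∷ _) = ⊥
NoThree [] = ⊤
NoThree (_ ∷ ds) = NoThree ds

Canonical : List Bool → ℕ → Set
Canonical ds N = (valueFrom 3 ds ≡ N) × NoThree ds

outVal : List Bool → ℕ
outVal ds = valueFrom 4 ds

HasD0 : ℕ → Set
HasD0 N = Σ (List Bool) λ ds → Canonical ds N × Σ (List Bool) λ rest → ds ≡ true ∷ rest

ExactlyCount : (ℕ → Set) → ℕ → Set
ExactlyCount P k =
  Σ (List ℕ) λ ms → (length ms ≡ k) × Unique ms × All P ms ×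
    (∀ m → P m → m ∈ ms)

IsRthSmallest : (ℕ → Set) → ℕ → ℕ → Set
IsRthSmallest P r n =
  (0 < n) × P n × ExactlyCount (λ m → (0 < m) × P m × (m < n)) (r ∸ 1)

-- Trithoff array.  A r k stands for T_{r,k+1} (rows r = 1,2,3,...,
-- columns c = k+1 ≥ 1); the row index 0 is unused.

IsTrithoff : (ℕ → ℕ → ℕ) → Set
IsTrithoff A =
  (∀ r → 1 ≤ r → IsRthSmallest HasD0 r (A r 0)) ×
  (∀ r → 1 ≤ r → ∀ k → Σ (List Bool) λ ds →
       Canonical ds (A r k) × (A r (suc k) ≡ outVal ds))

-- leftward extension by the Tribonacci rule T_{r,c} = T_{r,c+3} - T_{r,c+2} - T_{r,c+1}.
-- leftTriple A r j = (T_{r,-j}, T_{r,-j+1}, T_{r,-j+2})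
leftTriple : (ℕ → ℕ → ℕ) → ℕ → ℕ → ℤ × ℤ × ℤ
leftTriple A r zero =
  ((+ A r 2) ℤ.- (+ A r 1) ℤ.- (+ A r 0)) , + A r 0 , + A r 1
leftTriple A r (suc j) with leftTriple A r j
... | (x , y , z) = (z ℤ.- y ℤ.- x) , x , y

leftCol : (ℕ → ℕ → ℕ) → ℕ → ℕ → ℤ
leftCol A r j with leftTriple A r j
... | (x , _ , _) = x

data Letter : Set where
  a b c : Letter

W : ℕ → List Letter
W 0 = a ∷ []
W 1 = a ∷ b ∷ []
W 2 = a ∷ b ∷ a ∷ c ∷ []
W (suc (suc (suc n))) = W (suc (suc n)) ++ W (suc n) ++ W n

nth : {A : Set} → List A → ℕ → Maybe A
nth [] _ = nothing
nth (x ∷ xs) zero = just x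
nth (x ∷ xs) (suc i) = nth xs i

-- letter at position p ≥ 1 of the infinite Tribonacci word
-- (W p is a prefix of length ≥ p+1, so this is always defined for p ≥ 1)
tribWord : ℕ → Maybe Letter
tribWord p = nth (W p) (p ∸ 1)

StrictlyIncr : (ℕ → ℤ) → Set
StrictlyIncr f = ∀ r s → 1 ≤ r → r < s → f r ℤ.< f s

NonDecr : (ℕ → ℤ) → Set
NonDecr f = ∀ r s → 1 ≤ r → r ≤ s → f r ℤ.≤ f s

OccursExactly : (ℕ → ℤ) → ℤ → ℕ → Set
OccursExactly f v k = ExactlyCount (λ r → (1 ≤ r) × (f r ≡ v)) k

-- Write T_{r,1} canonically as 1 followed by digits e. Running the Tribonacci rule backwards
-- shifts the digits down, so T_{r,0}, T_{r,-1}, T_{r,-2} are e read with weights starting at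
-- T_2, T_1, T_0 respectively. The Tribonacci word is the fixed point of σ = (a ↦ ab, b ↦ ac, c ↦ a),
-- and the canonical digits of m locate position m + 1 in it: since |σ u| = |u| + #a u + #b u,
-- #a (σ u) = |u| and #b (σ u) = #a u, the prefix of length m contains valueFrom 2 and valueFrom 1
-- letters a and b, and the letter at position m + 1 is read off the two lowest digits
-- (0 ↦ a, 10 ↦ b, 11 ↦ c). Rows are ordered like the number e represents, and e runs through all
-- representations not starting with 11, i.e. all m such that position m + 1 carries a or b. The
-- multiplicities in the seed and pre-seed then come from a case analysis of the lowest digits of e.

module Submission where

open import Defs
open import Data.Nat using (ℕ; zero; suc; _+_; _∸_; _⊓_; _<?_; _≤_; _<_; _≤′_; ≤′-refl; ≤′-step; z≤n; s≤s)
open import Data.Nat.Properties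
open import Data.Nat.Tactic.RingSolver using (solve-∀)
open import Data.Integer as ℤ using (ℤ; +_)
import Data.Integer.Properties as ℤ
open import Data.Integer.Tactic.RingSolver renaming (solve-∀ to ℤ-solve-∀)
open import Data.Bool using (Bool; true; false)
open import Data.List using (List; []; _∷_; _++_; length; take; filter; upTo)
open import Data.List.Properties
  using (++-assoc; ++-identityʳ; length-++; length-++-sucʳ; length-++-≤ˡ; take-take; take++drop≡id)
open import Data.Product using (Σ; ∃; ∃₂; _×_; _,_; proj₁; proj₂)
open import Data.Sum using (_⊎_; inj₁; inj₂)
open import Data.Empty using (⊥; ⊥-elim)
open import Data.List.Membership.Propositional using (_∈_)
open import Data.List.Relation.Binary.Subset.Propositional using (_⊆_)
open import Data.List.Relation.Unary.Any using (here; there)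
open import Data.List.Relation.Unary.All as All using (All; []; _∷_)
open import Data.List.Relation.Unary.AllPairs using ([]; _∷_)
open import Data.List.Relation.Unary.Unique.Propositional using (Unique)
open import Data.List.Relation.Unary.Unique.Propositional.Properties using (filter⁺; upTo⁺)
open import Data.List.Membership.Propositional.Properties using (∈-filter⁺; ∈-filter⁻; ∈-upTo⁺; ∈-upTo⁻)
open import Data.Unit using (tt)
open import Data.Maybe using (just)
open import Data.Maybe.Properties using (just-injective)
open import Function using (_∘_; case_of_)
open import Function.Bundles using (_⇔_; mk⇔)
open import Relation.Nullary using (yes; no; _×-dec_)
open import Relation.Unary using (Decidable)
open import Relation.Binary.Definitions using (tri<; tri≈; tri>)
open import Relation.Binary.PropositionalEquality
open ≡-Reasoning

module _ {A : Set} where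
  private
    remove : ∀ {x : A} ys → x ∈ ys → List A
    remove (y ∷ ys) (here _) = ys
    remove (y ∷ ys) (there p) = y ∷ remove ys p

    length-remove : ∀ {x : A} ys (p : x ∈ ys) → suc (length (remove ys p)) ≡ length ys
    length-remove (y ∷ ys) (here _) = refl
    length-remove (y ∷ ys) (there p) = cong suc (length-remove ys p)

    ∈-remove : ∀ {x z : A} ys (p : x ∈ ys) → z ∈ ys → z ≢ x → z ∈ remove ys p
    ∈-remove (y ∷ ys) (here refl) (here refl) z≢x = ⊥-elim (z≢x refl)
    ∈-remove (y ∷ ys) (here refl) (there q) z≢x = q
    ∈-remove (y ∷ ys) (there p) (here refl) z≢x = here refl
    ∈-remove (y ∷ ys) (there p) (there q) z≢x = there (∈-remove ys p q z≢x)

  Unique-⊆⇒length-≤ : ∀ {xs ys : List A} → Unique xs → xs ⊆ ys → length xs ≤ length ys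
  Unique-⊆⇒length-≤ {[]} _ _ = z≤n
  Unique-⊆⇒length-≤ {x ∷ xs} {ys} (x∉xs ∷ xs!) xs⊆ys =
    ≤-trans (s≤s (Unique-⊆⇒length-≤ xs! xs⊆ys−x)) (≤-reflexive (length-remove ys x∈ys))
    where
    x∈ys = xs⊆ys (here refl)
    xs⊆ys−x : xs ⊆ remove ys x∈ys
    xs⊆ys−x z∈xs = ∈-remove ys x∈ys (xs⊆ys (there z∈xs)) (λ z≡x → All.lookup x∉xs z∈xs (sym z≡x))

module _ {P : ℕ → Set} where

  rank-mono-≤ : ∀ {r s x y} → IsRthSmallest P r x → IsRthSmallest P s y → x ≤ y → r ∸ 1 ≤ s ∸ 1
  rank-mono-≤ (_ , _ , msx , |msx| , msx! , below-x , _) (_ , _ , msy , |msy| , _ , _ , all-y) x≤y =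
    subst₂ _≤_ |msx| |msy| (Unique-⊆⇒length-≤ msx! msx⊆msy)
    where
    msx⊆msy : msx ⊆ msy
    msx⊆msy m∈ = let (0<m , Pm , m<x) = All.lookup below-x m∈ in all-y _ (0<m , Pm , <-≤-trans m<x x≤y)

  rank-mono-< : ∀ {r s x y} → IsRthSmallest P r x → IsRthSmallest P s y → x < y → r ∸ 1 < s ∸ 1
  rank-mono-< (0<x , Px , msx , |msx| , msx! , below-x , _) (_ , _ , msy , |msy| , _ , _ , all-y) x<y =
    subst₂ _≤_ (cong suc |msx|) |msy| (Unique-⊆⇒length-≤ (x∉msx ∷ msx!) x∷msx⊆msy)
    where
    x∉msx : All (_ ≢_) msx
    x∉msx = All.map (λ (_ , _ , m<x) x≡m → <-irrefl (sym x≡m) m<x) below-x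
    x∷msx⊆msy : _ ∷ msx ⊆ msy
    x∷msx⊆msy (here refl) = all-y _ (0<x , Px , x<y)
    x∷msx⊆msy (there m∈) = let (0<m , Pm , m<x) = All.lookup below-x m∈ in all-y _ (0<m , Pm , <-trans m<x x<y)

  rthSmallest-unique : ∀ {r x y} → IsRthSmallest P r x → IsRthSmallest P r y → x ≡ y
  rthSmallest-unique {r} {x} {y} rx ry with <-cmp x y
  ... | tri< x<y _ _ = ⊥-elim (<-irrefl refl (rank-mono-< {r} {r} rx ry x<y))
  ... | tri≈ _ x≡y _ = x≡y
  ... | tri> _ _ y<x = ⊥-elim (<-irrefl refl (rank-mono-< {r} {r} ry rx y<x))

  rthSmallest-strictMono : ∀ {r s x y} → 1 ≤ r → r < s → IsRthSmallest P r x → IsRthSmallest P s y → x < y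
  rthSmallest-strictMono {r} {s} {x} {y} 1≤r r<s rx sy with x <? y
  ... | yes x<y = x<y
  ... | no x≮y = ⊥-elim (<⇒≱ (∸-monoˡ-< r<s 1≤r) (rank-mono-≤ {s} {r} sy rx (≮⇒≥ x≮y)))

  rthSmallest-exists : Decidable P → ∀ {n} → 0 < n → P n → ∃ λ r → 1 ≤ r × IsRthSmallest P r n
  rthSmallest-exists P? {n} 0<n Pn =
    suc (length ms) , s≤s z≤n , 0<n , Pn , ms , refl , filter⁺ Q? (upTo⁺ n) , All.tabulate below , complete
    where
    Q? : Decidable (λ m → (0 < m) × P m)
    Q? m = 0 <? m ×-dec P? m
    ms = filter Q? (upTo n)
    below : ∀ {m} → m ∈ ms → (0 < m) × P m × (m < n)
    below m∈ = let (m∈upTo , 0<m , Pm) = ∈-filter⁻ Q? m∈ in 0<m , Pm , ∈-upTo⁻ m∈upTo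
    complete : ∀ m → (0 < m) × P m × (m < n) → m ∈ ms
    complete m (0<m , Pm , m<n) = ∈-filter⁺ Q? (∈-upTo⁺ m<n) (0<m , Pm)

value : List Bool → ℕ
value = valueFrom 3

valueFrom-rec : ∀ k ds →
  valueFrom (3 + k) ds ≡ valueFrom (2 + k) ds + valueFrom (1 + k) ds + valueFrom k ds
valueFrom-rec k [] = refl
valueFrom-rec k (false ∷ ds) = valueFrom-rec (suc k) ds
valueFrom-rec k (true ∷ ds) = begin
  trib (3 + k) + valueFrom (4 + k) ds
    ≡⟨ cong (λ z → trib (3 + k) + z) (valueFrom-rec (suc k) ds) ⟩
  trib (3 + k) + (valueFrom (3 + k) ds + valueFrom (2 + k) ds + valueFrom (1 + k) ds)
    ≡⟨ regroup (trib (2 + k)) (trib (1 + k)) (trib k) _ _ _ ⟩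
  (trib (2 + k) + valueFrom (3 + k) ds) + (trib (1 + k) + valueFrom (2 + k) ds)
    + (trib k + valueFrom (1 + k) ds) ∎
  where
  regroup : ∀ p q r x y z → (p + q + r) + (x + y + z) ≡ (p + x) + (q + y) + (r + z)
  regroup = solve-∀

NoThree-tail : ∀ d ds → NoThree (d ∷ ds) → NoThree ds
NoThree-tail false ds h = h
NoThree-tail true [] h = h
NoThree-tail true (false ∷ ds) h = h
NoThree-tail true (true ∷ []) h = h
NoThree-tail true (true ∷ false ∷ ds) h = h

-- T_k + T_{k+1} + T_{k+2} = T_{k+3}: a block 1 1 1 carries into 0 0 0 1.
prepend1 : List Bool → List Bool
prepend1 (true ∷ true ∷ []) = false ∷ false ∷ false ∷ true ∷ []
prepend1 (true ∷ true ∷ false ∷ u) = false ∷ false ∷ false ∷ prepend1 u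
prepend1 t = true ∷ t

private
  carry : ∀ p q r v → (p + q + r) + v ≡ r + (q + (p + v))
  carry = solve-∀

prepend1-value : ∀ k t → NoThree t → valueFrom k (prepend1 t) ≡ trib k + valueFrom (suc k) t
prepend1-value k [] h = refl
prepend1-value k (false ∷ t) h = refl
prepend1-value k (true ∷ []) h = refl
prepend1-value k (true ∷ false ∷ t) h = refl
prepend1-value k (true ∷ true ∷ []) h = carry (trib (2 + k)) (trib (1 + k)) (trib k) 0
prepend1-value k (true ∷ true ∷ false ∷ u) h =
  trans (prepend1-value (3 + k) u h) (carry (trib (2 + k)) (trib (1 + k)) (trib k) (valueFrom (4 + k) u))

prepend1-noThree : ∀ t → NoThree t → NoThree (prepend1 t)
prepend1-noThree [] h = tt
prepend1-noThree (false ∷ t) h = h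
prepend1-noThree (true ∷ []) h = tt
prepend1-noThree (true ∷ false ∷ t) h = h
prepend1-noThree (true ∷ true ∷ []) h = tt
prepend1-noThree (true ∷ true ∷ false ∷ u) h = prepend1-noThree u h

increment : List Bool → List Bool
increment [] = prepend1 []
increment (false ∷ t) = prepend1 t
increment (true ∷ []) = false ∷ prepend1 []
increment (true ∷ false ∷ t) = false ∷ prepend1 t
increment (true ∷ true ∷ []) = false ∷ false ∷ prepend1 []
increment (true ∷ true ∷ false ∷ t) = false ∷ false ∷ prepend1 t
increment ds@(true ∷ true ∷ true ∷ _) = ds

increment-value : ∀ ds → NoThree ds → value (increment ds) ≡ suc (value ds)
increment-value [] h = refl
increment-value (false ∷ t) h = prepend1-value 3 t h
increment-value (true ∷ []) h = refl
increment-value (true ∷ false ∷ t) h = prepend1-value 4 t h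
increment-value (true ∷ true ∷ []) h = refl
increment-value (true ∷ true ∷ false ∷ t) h = prepend1-value 5 t h

increment-noThree : ∀ ds → NoThree ds → NoThree (increment ds)
increment-noThree [] h = tt
increment-noThree (false ∷ t) h = prepend1-noThree t h
increment-noThree (true ∷ []) h = tt
increment-noThree (true ∷ false ∷ t) h = prepend1-noThree t h
increment-noThree (true ∷ true ∷ []) h = tt
increment-noThree (true ∷ true ∷ false ∷ t) h = prepend1-noThree t h

repr : ℕ → List Bool
repr zero = []
repr (suc n) = increment (repr n)

repr-noThree : ∀ n → NoThree (repr n)
repr-noThree zero = tt
repr-noThree (suc n) = increment-noThree (repr n) (repr-noThree n)

repr-value : ∀ n → value (repr n) ≡ n
repr-value zero = refl
repr-value (suc n) = trans (increment-value (repr n) (repr-noThree n)) (cong suc (repr-value n))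

letterOf : List Bool → Letter
letterOf (true ∷ true ∷ _) = c
letterOf (true ∷ _) = b
letterOf _ = a

letterOf-true≢a : ∀ t → letterOf (true ∷ t) ≢ a
letterOf-true≢a [] ()
letterOf-true≢a (false ∷ t) ()
letterOf-true≢a (true ∷ t) ()

letterOf-a⇒letterOf-true≡b : ∀ t → letterOf t ≡ a → letterOf (true ∷ t) ≡ b
letterOf-a⇒letterOf-true≡b [] _ = refl
letterOf-a⇒letterOf-true≡b (false ∷ t) _ = refl
letterOf-a⇒letterOf-true≡b (true ∷ []) ()
letterOf-a⇒letterOf-true≡b (true ∷ false ∷ t) ()
letterOf-a⇒letterOf-true≡b (true ∷ true ∷ t) ()

NoThree-true⇒letterOf≢c : ∀ t → NoThree (true ∷ t) → letterOf t ≢ c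
NoThree-true⇒letterOf≢c [] _ ()
NoThree-true⇒letterOf≢c (false ∷ t) _ ()
NoThree-true⇒letterOf≢c (true ∷ []) _ ()
NoThree-true⇒letterOf≢c (true ∷ false ∷ t) _ ()

letterOf≢c⇒NoThree-true : ∀ t → NoThree t → letterOf t ≢ c → NoThree (true ∷ t)
letterOf≢c⇒NoThree-true [] _ _ = tt
letterOf≢c⇒NoThree-true (false ∷ t) h _ = h
letterOf≢c⇒NoThree-true (true ∷ []) _ _ = tt
letterOf≢c⇒NoThree-true (true ∷ false ∷ t) h _ = h
letterOf≢c⇒NoThree-true (true ∷ true ∷ t) _ ≢c = ⊥-elim (≢c refl)

letterOf-a⇒NoThree-true-true : ∀ t → NoThree t → letterOf t ≡ a → NoThree (true ∷ true ∷ t)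
letterOf-a⇒NoThree-true-true [] _ _ = tt
letterOf-a⇒NoThree-true-true (false ∷ t) h _ = h
letterOf-a⇒NoThree-true-true (true ∷ t) _ la = ⊥-elim (letterOf-true≢a t la)

NoThree-true-true⇒letterOf-a : ∀ t → NoThree (true ∷ true ∷ t) → letterOf t ≡ a
NoThree-true-true⇒letterOf-a [] _ = refl
NoThree-true-true⇒letterOf-a (false ∷ t) _ = refl

≢c⇒a⊎b : ∀ {x} → x ≢ c → (just x ≡ just a) ⊎ (just x ≡ just b)
≢c⇒a⊎b {a} _ = inj₁ refl
≢c⇒a⊎b {b} _ = inj₂ refl
≢c⇒a⊎b {c} ≢c = ⊥-elim (≢c refl)

a⊎b⇒≢c : ∀ {x} → (just x ≡ just a) ⊎ (just x ≡ just b) → x ≢ c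
a⊎b⇒≢c (inj₁ refl) ()
a⊎b⇒≢c (inj₂ refl) ()

σ : Letter → List Letter
σ a = a ∷ b ∷ []
σ b = a ∷ c ∷ []
σ c = a ∷ []

σ* : List Letter → List Letter
σ* [] = []
σ* (x ∷ u) = σ x ++ σ* u

σ*-++ : ∀ u v → σ* (u ++ v) ≡ σ* u ++ σ* v
σ*-++ [] v = refl
σ*-++ (x ∷ u) v = trans (cong (σ x ++_) (σ*-++ u v)) (sym (++-assoc (σ x) (σ* u) (σ* v)))

σ*-W : ∀ n → σ* (W n) ≡ W (suc n)
σ*-W 0 = refl
σ*-W 1 = refl
σ*-W 2 = refl
σ*-W (suc (suc (suc n))) = begin
  σ* (W (2 + n) ++ W (1 + n) ++ W n)
    ≡⟨ σ*-++ (W (2 + n)) _ ⟩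
  σ* (W (2 + n)) ++ σ* (W (1 + n) ++ W n)
    ≡⟨ cong (σ* (W (2 + n)) ++_) (σ*-++ (W (1 + n)) (W n)) ⟩
  σ* (W (2 + n)) ++ σ* (W (1 + n)) ++ σ* (W n)
    ≡⟨ cong₂ _++_ (σ*-W (suc (suc n))) (cong₂ _++_ (σ*-W (suc n)) (σ*-W n)) ⟩
  W (4 + n) ∎

#a #b : List Letter → ℕ
#a [] = 0
#a (a ∷ u) = suc (#a u)
#a (_ ∷ u) = #a u
#b [] = 0
#b (b ∷ u) = suc (#b u)
#b (_ ∷ u) = #b u

#a-++ : ∀ u v → #a (u ++ v) ≡ #a u + #a v
#a-++ [] v = refl
#a-++ (a ∷ u) v = cong suc (#a-++ u v)
#a-++ (b ∷ u) v = #a-++ u v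
#a-++ (c ∷ u) v = #a-++ u v

#b-++ : ∀ u v → #b (u ++ v) ≡ #b u + #b v
#b-++ [] v = refl
#b-++ (a ∷ u) v = #b-++ u v
#b-++ (b ∷ u) v = cong suc (#b-++ u v)
#b-++ (c ∷ u) v = #b-++ u v

#a-σ* : ∀ u → #a (σ* u) ≡ length u
#a-σ* [] = refl
#a-σ* (a ∷ u) = cong suc (#a-σ* u)
#a-σ* (b ∷ u) = cong suc (#a-σ* u)
#a-σ* (c ∷ u) = cong suc (#a-σ* u)

#b-σ* : ∀ u → #b (σ* u) ≡ #a u
#b-σ* [] = refl
#b-σ* (a ∷ u) = cong suc (#b-σ* u)
#b-σ* (b ∷ u) = #b-σ* u
#b-σ* (c ∷ u) = #b-σ* u

length-σ* : ∀ u → length (σ* u) ≡ length u + #a u + #b u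
length-σ* [] = refl
length-σ* (a ∷ u) = trans (cong (λ z → 2 + z) (length-σ* u)) (shift (length u) (#a u) (#b u))
  where
  shift : ∀ l p q → 2 + (l + p + q) ≡ suc l + suc p + q
  shift = solve-∀
length-σ* (b ∷ u) = trans (cong (λ z → 2 + z) (length-σ* u)) (shift (length u) (#a u) (#b u))
  where
  shift : ∀ l p q → 2 + (l + p + q) ≡ suc l + p + suc q
  shift = solve-∀
length-σ* (c ∷ u) = cong suc (length-σ* u)

σ-head : ∀ x → ∃ λ r → σ x ≡ a ∷ r
σ-head a = _ , refl
σ-head b = _ , refl
σ-head c = _ , refl

σ-letterOf-true : ∀ t → NoThree (true ∷ t) → σ (letterOf t) ≡ a ∷ letterOf (true ∷ t) ∷ []
σ-letterOf-true [] h = refl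
σ-letterOf-true (false ∷ t) h = refl
σ-letterOf-true (true ∷ []) h = refl
σ-letterOf-true (true ∷ false ∷ t) h = refl

W-suc-split : ∀ k {u x v} → W k ≡ u ++ x ∷ v → W (suc k) ≡ σ* u ++ σ x ++ σ* v
W-suc-split k {u} {x} {v} eq = begin
  W (suc k)          ≡⟨ sym (σ*-W k) ⟩
  σ* (W k)           ≡⟨ cong σ* eq ⟩
  σ* (u ++ x ∷ v)    ≡⟨ σ*-++ u (x ∷ v) ⟩
  σ* u ++ σ x ++ σ* v ∎

length-σ*-shift : ∀ u t → length u ≡ value t → #a u ≡ valueFrom 2 t → #b u ≡ valueFrom 1 t →
  length (σ* u) ≡ valueFrom 4 t
length-σ*-shift u t len #a-u #b-u = begin
  length (σ* u)                               ≡⟨ length-σ* u ⟩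
  length u + #a u + #b u                      ≡⟨ cong₂ _+_ (cong₂ _+_ len #a-u) #b-u ⟩
  value t + valueFrom 2 t + valueFrom 1 t     ≡⟨ sym (valueFrom-rec 1 t) ⟩
  valueFrom 4 t                               ∎

-- Applying σ to a prefix shifts its digits one place up; a lowest digit 1 appends one more letter a.
record WordSplit (ds : List Bool) : Set where
  field
    level : ℕ
    before after : List Letter
    W-split : W level ≡ before ++ letterOf ds ∷ after
    length-before : length before ≡ value ds
    #a-before : #a before ≡ valueFrom 2 ds
    #b-before : #b before ≡ valueFrom 1 ds

wordSplit : ∀ ds → NoThree ds → WordSplit ds
wordSplit [] h = record
  { level = 0 ; before = [] ; after = [] ; W-split = refl
  ; length-before = refl ; #a-before = refl ; #b-before = refl }
wordSplit (false ∷ t) h with wordSplit t h | σ-head (letterOf t)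
... | s | r , σ-t = record
  { level = suc level
  ; before = σ* before
  ; after = r ++ σ* after
  ; W-split = trans (W-suc-split level W-split) (cong (λ z → σ* before ++ z ++ σ* after) σ-t)
  ; length-before = length-σ*-shift before t length-before #a-before #b-before
  ; #a-before = trans (#a-σ* before) length-before
  ; #b-before = trans (#b-σ* before) #a-before }
  where open WordSplit s
wordSplit (true ∷ t) h with wordSplit t (NoThree-tail true t h)
... | s = record
  { level = suc level
  ; before = σ* before ++ a ∷ []
  ; after = σ* after
  ; W-split = begin
      W (suc level)
        ≡⟨ W-suc-split level W-split ⟩
      σ* before ++ σ (letterOf t) ++ σ* after
        ≡⟨ cong (λ z → σ* before ++ z ++ σ* after) (σ-letterOf-true t h) ⟩
      σ* before ++ a ∷ letterOf (true ∷ t) ∷ σ* after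
        ≡⟨ sym (++-assoc (σ* before) (a ∷ []) _) ⟩
      (σ* before ++ a ∷ []) ++ letterOf (true ∷ t) ∷ σ* after ∎
  ; length-before = trans (length-++ (σ* before)) (trans (+-comm _ 1)
      (cong suc (length-σ*-shift before t length-before #a-before #b-before)))
  ; #a-before = trans (#a-++ (σ* before) (a ∷ [])) (trans (+-comm _ 1)
      (cong suc (trans (#a-σ* before) length-before)))
  ; #b-before = trans (#b-++ (σ* before) (a ∷ [])) (trans (+-identityʳ _)
      (trans (#b-σ* before) #a-before)) }
  where open WordSplit s

W-extends-suc : ∀ n → ∃₂ λ x e → W (suc n) ≡ W n ++ x ∷ e
W-extends-suc zero = b , [] , refl
W-extends-suc (suc n) with W-extends-suc n
... | x , e , eq with σ-head x
...   | r , σ-x = a , r ++ σ* e , (begin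
  W (2 + n)                        ≡⟨ W-suc-split (suc n) eq ⟩
  σ* (W n) ++ σ x ++ σ* e          ≡⟨ cong₂ (λ u z → u ++ z ++ σ* e) (σ*-W n) σ-x ⟩
  W (suc n) ++ a ∷ r ++ σ* e       ∎)

W-extends : ∀ {k j} → k ≤′ j → ∃ λ e → W j ≡ W k ++ e
W-extends {k} ≤′-refl = [] , sym (++-identityʳ (W k))
W-extends {k} (≤′-step {j} k≤j) with W-extends k≤j | W-extends-suc j
... | e , eq | x , e′ , eq′ = e ++ x ∷ e′ , trans eq′ (trans (cong (_++ x ∷ e′) eq) (++-assoc (W k) e _))

length-W : ∀ n → n < length (W n)
length-W zero = s≤s z≤n
length-W (suc n) with W-extends-suc n
... | x , e , eq rewrite eq | length-++-sucʳ (W n) x e =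
  s≤s (≤-trans (length-W n) (length-++-≤ˡ (W n)))

prefix : ℕ → List Letter
prefix n = take n (W n)

take-++ˡ : ∀ {A : Set} n (xs ys : List A) → n ≤ length xs → take n (xs ++ ys) ≡ take n xs
take-++ˡ zero xs ys h = refl
take-++ˡ (suc n) (x ∷ xs) ys (s≤s h) = cong (x ∷_) (take-++ˡ n xs ys h)

take-W : ∀ {n} k → n ≤ length (W k) → take n (W k) ≡ prefix n
take-W {n} k n≤|Wk| with ≤-total k n
... | inj₁ k≤n with W-extends (≤⇒≤′ k≤n)
...   | e , eq = sym (trans (cong (take n) eq) (take-++ˡ n (W k) e n≤|Wk|))
take-W {n} k n≤|Wk| | inj₂ n≤k with W-extends (≤⇒≤′ n≤k)
...   | e , eq = trans (cong (take n) eq) (take-++ˡ n (W n) e (<⇒≤ (length-W n)))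

take-length-++ : ∀ {A : Set} (u v : List A) → take (length u) (u ++ v) ≡ u
take-length-++ [] v = refl
take-length-++ (x ∷ u) v = cong (x ∷_) (take-length-++ u v)

prefix-split : ∀ k u {v} → W k ≡ u ++ v → prefix (length u) ≡ u
prefix-split k u {v} eq = begin
  prefix (length u)           ≡⟨ sym (take-W k (subst (length u ≤_) (cong length (sym eq)) (length-++-≤ˡ u))) ⟩
  take (length u) (W k)       ≡⟨ cong (take (length u)) eq ⟩
  take (length u) (u ++ v)    ≡⟨ take-length-++ u v ⟩
  u                           ∎

take-prefix : ∀ {m n} → m ≤ n → take m (prefix n) ≡ prefix m
take-prefix {m} {n} m≤n = begin
  take m (take n (W n))   ≡⟨ take-take m n (W n) ⟩
  take (m ⊓ n) (W n)      ≡⟨ cong (λ z → take z (W n)) (m≤n⇒m⊓n≡m m≤n) ⟩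
  take m (W n)            ≡⟨ take-W n (≤-trans m≤n (<⇒≤ (length-W n))) ⟩
  prefix m                ∎

Additive : (List Letter → ℕ) → Set
Additive f = ∀ u v → f (u ++ v) ≡ f u + f v

prefix-mono : ∀ f → Additive f → ∀ {m n} → m ≤ n → f (prefix m) ≤ f (prefix n)
prefix-mono f f-++ {m} {n} m≤n = subst (λ z → f z ≤ f (prefix n)) (take-prefix m≤n) take-≤
  where
  take-≤ : f (take m (prefix n)) ≤ f (prefix n)
  take-≤ = subst (f (take m (prefix n)) ≤_)
    (trans (sym (f-++ (take m (prefix n)) _)) (cong f (take++drop≡id m (prefix n))))
    (m≤m+n _ _)

nth-take : ∀ {A : Set} {i n} (xs : List A) → i < n → nth (take n xs) i ≡ nth xs i
nth-take {i = zero} {suc n} [] _ = refl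
nth-take {i = zero} {suc n} (x ∷ xs) _ = refl
nth-take {i = suc i} {suc n} [] _ = refl
nth-take {i = suc i} {suc n} (x ∷ xs) (s≤s i<n) = nth-take xs i<n

nth-length-++ : ∀ {A : Set} (u : List A) x v → nth (u ++ x ∷ v) (length u) ≡ just x
nth-length-++ [] x v = refl
nth-length-++ (y ∷ u) x v = nth-length-++ u x v

nth-W : ∀ {i} k → i < length (W k) → nth (W k) i ≡ tribWord (suc i)
nth-W {i} k i<|Wk| = begin
  nth (W k) i                       ≡⟨ sym (nth-take (W k) ≤-refl) ⟩
  nth (take (suc i) (W k)) i        ≡⟨ cong (λ z → nth z i) (take-W k i<|Wk|) ⟩
  nth (prefix (suc i)) i            ≡⟨ nth-take (W (suc i)) ≤-refl ⟩
  nth (W (suc i)) i                 ∎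

tribWord-split : ∀ k {u x v} → W k ≡ u ++ x ∷ v → tribWord (suc (length u)) ≡ just x
tribWord-split k {u} {x} {v} eq = begin
  tribWord (suc (length u))   ≡⟨ sym (nth-W k |u|<|Wk|) ⟩
  nth (W k) (length u)        ≡⟨ cong (λ z → nth z (length u)) eq ⟩
  nth (u ++ x ∷ v) (length u) ≡⟨ nth-length-++ u x v ⟩
  just x                      ∎
  where
  |u|<|Wk| : length u < length (W k)
  |u|<|Wk| = subst (length u <_) (cong length (sym eq))
    (subst (length u <_) (sym (length-++-sucʳ u x v)) (s≤s (length-++-≤ˡ u)))

module _ (ds : List Bool) (h : NoThree ds) where
  open WordSplit (wordSplit ds h)

  tribWord-canonical : tribWord (suc (value ds)) ≡ just (letterOf ds)
  tribWord-canonical = subst (λ n → tribWord (suc n) ≡ just (letterOf ds)) length-before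
    (tribWord-split level W-split)

  #a-prefix-canonical : #a (prefix (value ds)) ≡ valueFrom 2 ds
  #a-prefix-canonical = begin
    #a (prefix (value ds))      ≡⟨ cong (#a ∘ prefix) (sym length-before) ⟩
    #a (prefix (length before)) ≡⟨ cong #a (prefix-split level before W-split) ⟩
    #a before                   ≡⟨ #a-before ⟩
    valueFrom 2 ds              ∎

  #b-prefix-canonical : #b (prefix (value ds)) ≡ valueFrom 1 ds
  #b-prefix-canonical = begin
    #b (prefix (value ds))      ≡⟨ cong (#b ∘ prefix) (sym length-before) ⟩
    #b (prefix (length before)) ≡⟨ cong #b (prefix-split level before W-split) ⟩
    #b before                   ≡⟨ #b-before ⟩
    valueFrom 1 ds              ∎

-- Canonical representations of a number may differ by trailing zeros, but not in any shifted value: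
-- valueFrom 2 and valueFrom 1 count the letters a and b in the same prefix of the word.
valueFrom-canonical : ∀ ds ds′ → NoThree ds → NoThree ds′ → value ds ≡ value ds′ →
  ∀ k → valueFrom k ds ≡ valueFrom k ds′
valueFrom-canonical ds ds′ h h′ eq 2 = begin
  valueFrom 2 ds           ≡⟨ sym (#a-prefix-canonical ds h) ⟩
  #a (prefix (value ds))   ≡⟨ cong (#a ∘ prefix) eq ⟩
  #a (prefix (value ds′))  ≡⟨ #a-prefix-canonical ds′ h′ ⟩
  valueFrom 2 ds′          ∎
valueFrom-canonical ds ds′ h h′ eq 1 = begin
  valueFrom 1 ds           ≡⟨ sym (#b-prefix-canonical ds h) ⟩
  #b (prefix (value ds))   ≡⟨ cong (#b ∘ prefix) eq ⟩
  #b (prefix (value ds′))  ≡⟨ #b-prefix-canonical ds′ h′ ⟩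
  valueFrom 1 ds′          ∎
valueFrom-canonical ds ds′ h h′ eq 0 = +-cancelˡ-≡ (valueFrom 2 ds + valueFrom 1 ds) _ _ (begin
  valueFrom 2 ds + valueFrom 1 ds + valueFrom 0 ds     ≡⟨ sym (valueFrom-rec 0 ds) ⟩
  value ds                                             ≡⟨ eq ⟩
  value ds′                                            ≡⟨ valueFrom-rec 0 ds′ ⟩
  valueFrom 2 ds′ + valueFrom 1 ds′ + valueFrom 0 ds′  ≡⟨ cong₂ (λ x y → x + y + valueFrom 0 ds′)
                                                           (sym (valueFrom-canonical ds ds′ h h′ eq 2))
                                                           (sym (valueFrom-canonical ds ds′ h h′ eq 1)) ⟩
  valueFrom 2 ds + valueFrom 1 ds + valueFrom 0 ds′    ∎)
valueFrom-canonical ds ds′ h h′ eq (suc (suc (suc k))) = begin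
  valueFrom (3 + k) ds                                       ≡⟨ valueFrom-rec k ds ⟩
  valueFrom (2 + k) ds + valueFrom (1 + k) ds + valueFrom k ds
    ≡⟨ cong₂ _+_ (cong₂ _+_ (same (suc (suc k))) (same (suc k))) (same k) ⟩
  valueFrom (2 + k) ds′ + valueFrom (1 + k) ds′ + valueFrom k ds′ ≡⟨ sym (valueFrom-rec k ds′) ⟩
  valueFrom (3 + k) ds′                                      ∎
  where
  same = valueFrom-canonical ds ds′ h h′ eq

letterOf-canonical : ∀ ds ds′ → NoThree ds → NoThree ds′ → value ds ≡ value ds′ →
  letterOf ds ≡ letterOf ds′
letterOf-canonical ds ds′ h h′ eq = just-injective (begin
  just (letterOf ds)          ≡⟨ sym (tribWord-canonical ds h) ⟩
  tribWord (suc (value ds))   ≡⟨ cong (tribWord ∘ suc) eq ⟩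
  tribWord (suc (value ds′))  ≡⟨ tribWord-canonical ds′ h′ ⟩
  just (letterOf ds′)         ∎)

out : ℕ → ℕ
out m = m + #a (prefix m) + #b (prefix m)

outVal-canonical : ∀ ds → NoThree ds → outVal ds ≡ out (value ds)
outVal-canonical ds h = trans (valueFrom-rec 1 ds)
  (cong₂ (λ x y → value ds + x + y) (sym (#a-prefix-canonical ds h)) (sym (#b-prefix-canonical ds h)))

out-mono-≤ : ∀ {m n} → m ≤ n → out m ≤ out n
out-mono-≤ m≤n = +-mono-≤ (+-mono-≤ m≤n (prefix-mono #a #a-++ m≤n)) (prefix-mono #b #b-++ m≤n)

outVal-cancel-< : ∀ ds ds′ → NoThree ds → NoThree ds′ → outVal ds < outVal ds′ → value ds < value ds′
outVal-cancel-< ds ds′ h h′ lt with value ds <? value ds′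
... | yes v<v′ = v<v′
... | no v≮v′ = ⊥-elim (<⇒≱ (subst₂ _<_ (outVal-canonical ds h) (outVal-canonical ds′ h′) lt)
                          (out-mono-≤ (≮⇒≥ v≮v′)))

valueFrom-repr : ∀ t {n} → NoThree t → value t ≡ n → ∀ k → valueFrom k t ≡ valueFrom k (repr n)
valueFrom-repr t {n} h v = valueFrom-canonical t (repr n) h (repr-noThree n) (trans v (sym (repr-value n)))

letterOf-repr : ∀ t {n} → NoThree t → value t ≡ n → letterOf t ≡ letterOf (repr n)
letterOf-repr t {n} h v = letterOf-canonical t (repr n) h (repr-noThree n) (trans v (sym (repr-value n)))

tribWord-repr : ∀ m → tribWord (suc m) ≡ just (letterOf (repr m))
tribWord-repr m = subst (λ n → tribWord (suc n) ≡ just (letterOf (repr m))) (repr-value m)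
  (tribWord-canonical (repr m) (repr-noThree m))

tribWord⇒letterOf-repr : ∀ m {x} → tribWord (suc m) ≡ just x → letterOf (repr m) ≡ x
tribWord⇒letterOf-repr m eq = just-injective (trans (sym (tribWord-repr m)) eq)

tribWord-a⊎b⇒letterOf≢c : ∀ m → (tribWord (suc m) ≡ just a) ⊎ (tribWord (suc m) ≡ just b) →
  letterOf (repr m) ≢ c
tribWord-a⊎b⇒letterOf≢c m = a⊎b⇒≢c ∘ subst (λ w → (w ≡ just a) ⊎ (w ≡ just b)) (tribWord-repr m)

HasD0⇒letterOf≢a : ∀ {n} → HasD0 n → letterOf (repr n) ≢ a
HasD0⇒letterOf≢a (.(true ∷ t) , (v , h) , t , refl) la =
  letterOf-true≢a t (trans (letterOf-repr (true ∷ t) h v) la)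

letterOf≢a⇒HasD0 : ∀ n → letterOf (repr n) ≢ a → HasD0 n
letterOf≢a⇒HasD0 n ≢a with repr n | repr-value n | repr-noThree n
... | true ∷ t | v | h = true ∷ t , (v , h) , t , refl
... | [] | _ | _ = ⊥-elim (≢a refl)
... | false ∷ t | _ | _ = ⊥-elim (≢a refl)

HasD0? : Decidable HasD0
HasD0? n with letterOf (repr n) in eq
... | a = no (λ h → HasD0⇒letterOf≢a h eq)
... | b = yes (letterOf≢a⇒HasD0 n (λ la → case trans (sym eq) la of λ ()))
... | c = yes (letterOf≢a⇒HasD0 n (λ la → case trans (sym eq) la of λ ()))

seed-zero : ∀ e → NoThree (true ∷ e) → valueFrom 2 e ≡ 0 → value e ≡ 0
seed-zero [] _ _ = refl
seed-zero (false ∷ t) h v = valueFrom-repr t h v 4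

preseed-zero : ∀ e → NoThree (true ∷ e) → valueFrom 1 e ≡ 0 → (value e ≡ 0) ⊎ (value e ≡ 1)
preseed-zero [] _ _ = inj₁ refl
preseed-zero (false ∷ []) _ _ = inj₁ refl
preseed-zero (false ∷ false ∷ s) h v = inj₁ (valueFrom-repr s h v 5)
preseed-zero (true ∷ []) _ _ = inj₂ refl
preseed-zero (true ∷ false ∷ s) h v = inj₂ (cong suc (valueFrom-repr s h v 5))

-- The representations e with a given seed value: a leading 0 shifts freely,
-- a leading 1 is possible only when it creates no block 111.
seed-preimage : ∀ {n} e → NoThree (true ∷ e) → valueFrom 2 e ≡ suc n →
  (value e ≡ value (false ∷ repr (suc n))) ⊎
  (letterOf (repr n) ≡ a × value e ≡ value (true ∷ repr n))
seed-preimage (false ∷ t) h v = inj₁ (valueFrom-repr t h v 4)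
seed-preimage (true ∷ t) h v =
  inj₂ (trans (sym (letterOf-repr t t-ok (suc-injective v))) (NoThree-true-true⇒letterOf-a t h) ,
        cong suc (valueFrom-repr t t-ok (suc-injective v) 4))
  where
  t-ok = NoThree-tail true t (NoThree-tail true (true ∷ t) h)

preseed-preimage : ∀ {n} e → NoThree (true ∷ e) → valueFrom 1 e ≡ suc n →
  (value e ≡ value (false ∷ false ∷ repr (suc n))) ⊎
  (value e ≡ value (true ∷ false ∷ repr (suc n))) ⊎
  (letterOf (repr n) ≢ c × value e ≡ value (false ∷ true ∷ repr n))
preseed-preimage (false ∷ false ∷ s) h v = inj₁ (valueFrom-repr s h v 5)
preseed-preimage (false ∷ true ∷ s) h v =
  inj₂ (inj₂ ((λ lc → NoThree-true⇒letterOf≢c s h (trans (letterOf-repr s s-ok (suc-injective v)) lc)) ,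
              cong (λ x → 2 + x) (valueFrom-repr s s-ok (suc-injective v) 5)))
  where
  s-ok = NoThree-tail true s h
preseed-preimage (true ∷ false ∷ s) h v = inj₂ (inj₁ (cong suc (valueFrom-repr s h v 5)))

+[m+n+o]-m-n≡o : ∀ m n o → + (m + n + o) ℤ.- + m ℤ.- + n ≡ + o
+[m+n+o]-m-n≡o m n o = begin
  + (m + n + o) ℤ.- + m ℤ.- + n          ≡⟨ cong (λ z → z ℤ.- + m ℤ.- + n) (ℤ.pos-+ (m + n) o) ⟩
  + (m + n) ℤ.+ + o ℤ.- + m ℤ.- + n      ≡⟨ cong (λ z → z ℤ.+ + o ℤ.- + m ℤ.- + n) (ℤ.pos-+ m n) ⟩
  + m ℤ.+ + n ℤ.+ + o ℤ.- + m ℤ.- + n    ≡⟨ cancel (+ m) (+ n) (+ o) ⟩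
  + o                                    ∎
  where
  cancel : ∀ x y z → x ℤ.+ y ℤ.+ z ℤ.- x ℤ.- y ≡ z
  cancel = ℤ-solve-∀

valueFrom-back : ∀ k D →
  + valueFrom (3 + k) D ℤ.- + valueFrom (2 + k) D ℤ.- + valueFrom (1 + k) D ≡ + valueFrom k D
valueFrom-back k D =
  trans (cong (λ z → + z ℤ.- + valueFrom (2 + k) D ℤ.- + valueFrom (1 + k) D) (valueFrom-rec k D))
        (+[m+n+o]-m-n≡o (valueFrom (2 + k) D) (valueFrom (1 + k) D) (valueFrom k D))

leftCol-valueFrom : ∀ T r D → T r 0 ≡ valueFrom 3 D → T r 1 ≡ valueFrom 4 D → T r 2 ≡ valueFrom 5 D →
  (leftCol T r 0 ≡ + valueFrom 2 D) × (leftCol T r 1 ≡ + valueFrom 1 D) × (leftCol T r 2 ≡ + valueFrom 0 D)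
leftCol-valueFrom T r D e₀ e₁ e₂ rewrite e₀ | e₁ | e₂ = col₀ , col₁ , col₂
  where
  col₀ = valueFrom-back 2 D
  col₁ = trans (cong (λ x → + valueFrom 4 D ℤ.- + valueFrom 3 D ℤ.- x) col₀) (valueFrom-back 1 D)
  col₂ = trans (cong₂ (λ x y → + valueFrom 3 D ℤ.- x ℤ.- y) col₀ col₁) (valueFrom-back 0 D)

module Rows (T : ℕ → ℕ → ℕ) (isT : IsTrithoff T) where

  record Row (r : ℕ) (e : List Bool) : Set where
    constructor row
    field
      positive : 1 ≤ r
      noThree : NoThree (true ∷ e)
      first : T r 0 ≡ value (true ∷ e)

  open Row

  noThree-tail : ∀ {r e} → Row r e → NoThree e
  noThree-tail {e = e} ρ = NoThree-tail true e (noThree ρ)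

  row-exists : ∀ {r} → 1 ≤ r → ∃ (Row r)
  row-exists {r} 1≤r with proj₁ isT r 1≤r
  ... | _ , (.(true ∷ e) , (v , h) , e , refl) , _ = e , row 1≤r h (sym v)

  row-for : ∀ e → NoThree (true ∷ e) → ∃ λ r → Row r e
  row-for e h with rthSmallest-exists HasD0? (s≤s z≤n) (true ∷ e , (refl , h) , e , refl)
  ... | r , 1≤r , rth = r , row 1≤r h (rthSmallest-unique {r = r} (proj₁ isT r 1≤r) rth)

  row-value-< : ∀ {r s e e′} → r < s → Row r e → Row s e′ → value e < value e′
  row-value-< {r} {s} {e} {e′} r<s ρ τ =
    outVal-cancel-< e e′ (noThree-tail ρ) (noThree-tail τ) (≤-pred (subst₂ _<_ (first ρ) (first τ)
      (rthSmallest-strictMono (positive ρ) r<s (proj₁ isT r (positive ρ)) (proj₁ isT s (positive τ)))))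

  row-value-≡ : ∀ {r e e′} → Row r e → Row r e′ → value e ≡ value e′
  row-value-≡ {e = e} {e′} ρ ρ′ = suc-injective
    (valueFrom-canonical (true ∷ e) (true ∷ e′) (noThree ρ) (noThree ρ′) (trans (sym (first ρ)) (first ρ′)) 2)

  row-value-≤ : ∀ {r s e e′} → r ≤ s → Row r e → Row s e′ → value e ≤ value e′
  row-value-≤ r≤s ρ τ with m≤n⇒m<n∨m≡n r≤s
  ... | inj₁ r<s = <⇒≤ (row-value-< r<s ρ τ)
  ... | inj₂ refl = ≤-reflexive (row-value-≡ ρ τ)

  row-≡ : ∀ {r s e e′} → Row r e → Row s e′ → value e ≡ value e′ → r ≡ s
  row-≡ {r} {s} ρ τ eq with <-cmp r s
  ... | tri< r<s _ _ = ⊥-elim (<-irrefl eq (row-value-< r<s ρ τ))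
  ... | tri≈ _ r≡s _ = r≡s
  ... | tri> _ _ s<r = ⊥-elim (<-irrefl (sym eq) (row-value-< s<r τ ρ))

  row-≢ : ∀ {r s e e′} → Row r e → Row s e′ → letterOf e ≢ letterOf e′ → r ≢ s
  row-≢ {e = e} {e′} ρ τ ≢ refl =
    ≢ (letterOf-canonical e e′ (noThree-tail ρ) (noThree-tail τ) (row-value-≡ ρ τ))

  leftCol-row : ∀ {r e} → Row r e →
    (leftCol T r 0 ≡ + suc (value e)) × (leftCol T r 1 ≡ + valueFrom 2 e) × (leftCol T r 2 ≡ + valueFrom 1 e)
  leftCol-row {r} {e} (row 1≤r h p) with proj₂ isT r 1≤r 0 | proj₂ isT r 1≤r 1
  ... | ds₁ , (v₁ , h₁) , q₁ | ds₂ , (v₂ , h₂) , q₂ = leftCol-valueFrom T r (true ∷ e) p second third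
    where
    second : T r 1 ≡ valueFrom 4 (true ∷ e)
    second = trans q₁ (valueFrom-canonical ds₁ (true ∷ e) h₁ h (trans v₁ p) 4)
    third : T r 2 ≡ valueFrom 5 (true ∷ e)
    third = trans q₂ (valueFrom-canonical ds₂ (false ∷ true ∷ e) h₂ h (trans v₂ second) 4)

  row₁-value : ∀ {e} → Row 1 e → value e ≡ 0
  row₁-value ρ with row-for [] tt
  ... | r₀ , ρ₀ = n≤0⇒n≡0 (row-value-≤ (positive ρ₀) ρ ρ₀)

  row₂-value : ∀ {e} → Row 2 e → value e ≡ 1
  row₂-value {e} ρ with row-for (true ∷ []) tt | row-exists {1} ≤-refl
  ... | r′ , τ | e₁ , ρ₁ = ≤-antisym (row-value-≤ 2≤r′ ρ τ)
      (subst (_< value e) (row₁-value ρ₁) (row-value-< ≤-refl ρ₁ ρ))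
    where
    2≤r′ : 2 ≤ r′
    2≤r′ = ≤∧≢⇒< (positive τ) (λ { refl → case row₁-value τ of λ () })

  row-of-value₀ : ∀ {r e} → Row r e → value e ≡ 0 → r ≡ 1
  row-of-value₀ ρ v≡0 with row-exists {1} ≤-refl
  ... | e₁ , ρ₁ = row-≡ ρ ρ₁ (trans v≡0 (sym (row₁-value ρ₁)))

  row-of-value₁ : ∀ {r e} → Row r e → value e ≡ 1 → r ≡ 2
  row-of-value₁ ρ v≡1 with row-exists {2} (s≤s z≤n)
  ... | e₂ , ρ₂ = row-≡ ρ ρ₂ (trans v≡1 (sym (row₂-value ρ₂)))

  wall-row : ∀ {r e} → Row r e → leftCol T r 0 ≡ + suc (value e)
  wall-row ρ = proj₁ (leftCol-row ρ)

  seed-row : ∀ {r e} → Row r e → leftCol T r 1 ≡ + valueFrom 2 e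
  seed-row ρ = proj₁ (proj₂ (leftCol-row ρ))

  preseed-row : ∀ {r e} → Row r e → leftCol T r 2 ≡ + valueFrom 1 e
  preseed-row ρ = proj₂ (proj₂ (leftCol-row ρ))

  wall-strictlyIncr : StrictlyIncr (λ r → leftCol T r 0)
  wall-strictlyIncr r s 1≤r r<s with row-exists 1≤r | row-exists (≤-trans 1≤r (<⇒≤ r<s))
  ... | e , ρ | e′ , τ =
    subst₂ ℤ._<_ (sym (wall-row ρ)) (sym (wall-row τ)) (ℤ.+<+ (s≤s (row-value-< r<s ρ τ)))

  wall-values : ∀ v → (Σ ℕ λ r → (1 ≤ r) × (leftCol T r 0 ≡ v)) ⇔
    (Σ ℕ λ n → (1 ≤ n) × (v ≡ + n) × ((tribWord n ≡ just a) ⊎ (tribWord n ≡ just b)))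
  wall-values v = mk⇔ to from
    where
    to : _
    to (r , 1≤r , eq) with row-exists 1≤r
    ... | e , ρ = suc (value e) , s≤s z≤n , trans (sym eq) (wall-row ρ) ,
      subst (λ w → (w ≡ just a) ⊎ (w ≡ just b)) (sym (tribWord-canonical e (noThree-tail ρ)))
        (≢c⇒a⊎b (NoThree-true⇒letterOf≢c e (noThree ρ)))
    from : _
    from (suc m , _ , refl , a⊎b)
      with row-for (repr m) (letterOf≢c⇒NoThree-true (repr m) (repr-noThree m) (tribWord-a⊎b⇒letterOf≢c m a⊎b))
    ... | r , ρ = r , positive ρ , trans (wall-row ρ) (cong (λ x → + suc x) (repr-value m))

  seed-nonDecr : NonDecr (λ r → leftCol T r 1)
  seed-nonDecr r s 1≤r r≤s with row-exists 1≤r | row-exists (≤-trans 1≤r r≤s)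
  ... | e , ρ | e′ , τ = subst₂ ℤ._≤_ (sym (seed-row ρ)) (sym (seed-row τ)) (ℤ.+≤+
    (subst₂ _≤_ (#a-prefix-canonical e (noThree-tail ρ)) (#a-prefix-canonical e′ (noThree-tail τ))
      (prefix-mono #a #a-++ (row-value-≤ r≤s ρ τ))))

  preseed-nonDecr : NonDecr (λ r → leftCol T r 2)
  preseed-nonDecr r s 1≤r r≤s with row-exists 1≤r | row-exists (≤-trans 1≤r r≤s)
  ... | e , ρ | e′ , τ = subst₂ ℤ._≤_ (sym (preseed-row ρ)) (sym (preseed-row τ)) (ℤ.+≤+
    (subst₂ _≤_ (#b-prefix-canonical e (noThree-tail ρ)) (#b-prefix-canonical e′ (noThree-tail τ))
      (prefix-mono #b #b-++ (row-value-≤ r≤s ρ τ))))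

  seed₁ : leftCol T 1 1 ≡ + 0
  seed₁ with row-exists {1} ≤-refl
  ... | e , ρ = trans (seed-row ρ) (cong +_ (valueFrom-canonical e [] (noThree-tail ρ) tt (row₁-value ρ) 2))

  preseed₁ : leftCol T 1 2 ≡ + 0
  preseed₁ with row-exists {1} ≤-refl
  ... | e , ρ = trans (preseed-row ρ) (cong +_ (valueFrom-canonical e [] (noThree-tail ρ) tt (row₁-value ρ) 1))

  preseed₂ : leftCol T 2 2 ≡ + 0
  preseed₂ with row-exists {2} (s≤s z≤n)
  ... | e , ρ = trans (preseed-row ρ)
    (cong +_ (valueFrom-canonical e (true ∷ []) (noThree-tail ρ) tt (row₂-value ρ) 1))

  seed-zero-once : OccursExactly (λ r → leftCol T r 1) (+ 0) 1
  seed-zero-once = 1 ∷ [] , refl , [] ∷ [] , (≤-refl , seed₁) ∷ [] , complete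
    where
    complete : ∀ r → (1 ≤ r) × (leftCol T r 1 ≡ + 0) → r ∈ 1 ∷ []
    complete r (1≤r , eq) with row-exists 1≤r
    ... | e , ρ = here (row-of-value₀ ρ (seed-zero e (noThree ρ) (ℤ.+-injective (trans (sym (seed-row ρ)) eq))))

  preseed-zero-twice : OccursExactly (λ r → leftCol T r 2) (+ 0) 2
  preseed-zero-twice = 1 ∷ 2 ∷ [] , refl , ((λ ()) ∷ []) ∷ [] ∷ [] , (≤-refl , preseed₁) ∷ (s≤s z≤n , preseed₂) ∷ [] ,
    complete
    where
    complete : ∀ r → (1 ≤ r) × (leftCol T r 2 ≡ + 0) → r ∈ 1 ∷ 2 ∷ []
    complete r (1≤r , eq) with row-exists 1≤r
    ... | e , ρ with preseed-zero e (noThree ρ) (ℤ.+-injective (trans (sym (preseed-row ρ)) eq))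
    ...   | inj₁ v≡0 = here (row-of-value₀ ρ v≡0)
    ...   | inj₂ v≡1 = there (here (row-of-value₁ ρ v≡1))

  seed-occurrences : ∀ n → 1 ≤ n →
    ((tribWord n ≡ just a) → OccursExactly (λ r → leftCol T r 1) (+ n) 2) ×
    ((tribWord n ≢ just a) → OccursExactly (λ r → leftCol T r 1) (+ n) 1)
  seed-occurrences (suc m) _ with row-for (false ∷ repr (suc m)) (repr-noThree (suc m))
  ... | r₁ , ρ₁ = twice ∘ tribWord⇒letterOf-repr m , once
    where
    at₁ : leftCol T r₁ 1 ≡ + suc m
    at₁ = trans (seed-row ρ₁) (cong +_ (repr-value (suc m)))

    classify : ∀ r → (1 ≤ r) × (leftCol T r 1 ≡ + suc m) → ∃ λ e → Row r e ×
      ((value e ≡ value (false ∷ repr (suc m))) ⊎ (letterOf (repr m) ≡ a × value e ≡ value (true ∷ repr m)))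
    classify r (1≤r , eq) with row-exists 1≤r
    ... | e , ρ = e , ρ , seed-preimage e (noThree ρ) (ℤ.+-injective (trans (sym (seed-row ρ)) eq))

    once : tribWord (suc m) ≢ just a → OccursExactly (λ r → leftCol T r 1) (+ suc m) 1
    once ≢a = r₁ ∷ [] , refl , [] ∷ [] , (positive ρ₁ , at₁) ∷ [] , complete
      where
      complete : ∀ r → (1 ≤ r) × (leftCol T r 1 ≡ + suc m) → r ∈ r₁ ∷ []
      complete r at with classify r at
      ... | e , ρ , inj₁ v = here (row-≡ ρ ρ₁ v)
      ... | e , ρ , inj₂ (la , _) = ⊥-elim (≢a (trans (tribWord-repr m) (cong just la)))

    twice : letterOf (repr m) ≡ a → OccursExactly (λ r → leftCol T r 1) (+ suc m) 2
    twice la with row-for (true ∷ repr m) (letterOf-a⇒NoThree-true-true (repr m) (repr-noThree m) la)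
    ... | r₂ , ρ₂ = r₁ ∷ r₂ ∷ [] , refl , (r₁≢r₂ ∷ []) ∷ [] ∷ [] , (positive ρ₁ , at₁) ∷ (positive ρ₂ , at₂) ∷ [] ,
      complete
      where
      at₂ : leftCol T r₂ 1 ≡ + suc m
      at₂ = trans (seed-row ρ₂) (cong (λ x → + suc x) (repr-value m))
      r₁≢r₂ : r₁ ≢ r₂
      r₁≢r₂ = row-≢ ρ₁ ρ₂ (λ a≡ → case trans a≡ (letterOf-a⇒letterOf-true≡b (repr m) la) of λ ())
      complete : ∀ r → (1 ≤ r) × (leftCol T r 1 ≡ + suc m) → r ∈ r₁ ∷ r₂ ∷ []
      complete r at with classify r at
      ... | e , ρ , inj₁ v = here (row-≡ ρ ρ₁ v)
      ... | e , ρ , inj₂ (_ , v) = there (here (row-≡ ρ ρ₂ v))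

  preseed-occurrences : ∀ n → 1 ≤ n →
    (((tribWord n ≡ just a) ⊎ (tribWord n ≡ just b)) → OccursExactly (λ r → leftCol T r 2) (+ n) 3) ×
    ((tribWord n ≡ just c) → OccursExactly (λ r → leftCol T r 2) (+ n) 2)
  preseed-occurrences (suc m) _
    with row-for (false ∷ false ∷ repr (suc m)) (repr-noThree (suc m))
       | row-for (true ∷ false ∷ repr (suc m)) (repr-noThree (suc m))
  ... | r₁ , ρ₁ | r₂ , ρ₂ = thrice ∘ tribWord-a⊎b⇒letterOf≢c m , twice ∘ tribWord⇒letterOf-repr m
    where
    at₁ : leftCol T r₁ 2 ≡ + suc m
    at₁ = trans (preseed-row ρ₁) (cong +_ (repr-value (suc m)))
    at₂ : leftCol T r₂ 2 ≡ + suc m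
    at₂ = trans (preseed-row ρ₂) (cong +_ (repr-value (suc m)))
    r₁≢r₂ : r₁ ≢ r₂
    r₁≢r₂ = row-≢ ρ₁ ρ₂ (λ ())

    classify : ∀ r → (1 ≤ r) × (leftCol T r 2 ≡ + suc m) → ∃ λ e → Row r e ×
      ((value e ≡ value (false ∷ false ∷ repr (suc m))) ⊎ (value e ≡ value (true ∷ false ∷ repr (suc m))) ⊎
       (letterOf (repr m) ≢ c × value e ≡ value (false ∷ true ∷ repr m)))
    classify r (1≤r , eq) with row-exists 1≤r
    ... | e , ρ = e , ρ , preseed-preimage e (noThree ρ) (ℤ.+-injective (trans (sym (preseed-row ρ)) eq))

    twice : letterOf (repr m) ≡ c → OccursExactly (λ r → leftCol T r 2) (+ suc m) 2
    twice lc = r₁ ∷ r₂ ∷ [] , refl , (r₁≢r₂ ∷ []) ∷ [] ∷ [] , (positive ρ₁ , at₁) ∷ (positive ρ₂ , at₂) ∷ [] ,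
      complete
      where
      complete : ∀ r → (1 ≤ r) × (leftCol T r 2 ≡ + suc m) → r ∈ r₁ ∷ r₂ ∷ []
      complete r at with classify r at
      ... | e , ρ , inj₁ v = here (row-≡ ρ ρ₁ v)
      ... | e , ρ , inj₂ (inj₁ v) = there (here (row-≡ ρ ρ₂ v))
      ... | e , ρ , inj₂ (inj₂ (≢c , _)) = ⊥-elim (≢c lc)

    thrice : letterOf (repr m) ≢ c → OccursExactly (λ r → leftCol T r 2) (+ suc m) 3
    thrice ≢c with row-for (false ∷ true ∷ repr m) (letterOf≢c⇒NoThree-true (repr m) (repr-noThree m) ≢c)
    ... | r₃ , ρ₃ = r₁ ∷ r₂ ∷ r₃ ∷ [] , refl , (r₁≢r₂ ∷ r₁≢r₃ ∷ []) ∷ (r₂≢r₃ ∷ []) ∷ [] ∷ [] ,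
      (positive ρ₁ , at₁) ∷ (positive ρ₂ , at₂) ∷ (positive ρ₃ , at₃) ∷ [] , complete
      where
      at₃ : leftCol T r₃ 2 ≡ + suc m
      at₃ = trans (preseed-row ρ₃) (cong (λ x → + suc x) (repr-value m))
      r₂≢r₃ : r₂ ≢ r₃
      r₂≢r₃ = row-≢ ρ₂ ρ₃ (λ ())
      -- Both representations end in the letter a; one digit further up they end in a and b.
      r₁≢r₃ : r₁ ≢ r₃
      r₁≢r₃ refl = letterOf-true≢a (repr m) (sym (letterOf-canonical (false ∷ repr (suc m)) (true ∷ repr m)
        (repr-noThree (suc m)) (noThree-tail ρ₃)
        (valueFrom-canonical (false ∷ false ∷ repr (suc m)) (false ∷ true ∷ repr m)
          (noThree-tail ρ₁) (noThree-tail ρ₃) (row-value-≡ ρ₁ ρ₃) 2)))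
      complete : ∀ r → (1 ≤ r) × (leftCol T r 2 ≡ + suc m) → r ∈ r₁ ∷ r₂ ∷ r₃ ∷ []
      complete r at with classify r at
      ... | e , ρ , inj₁ v = here (row-≡ ρ ρ₁ v)
      ... | e , ρ , inj₂ (inj₁ v) = there (here (row-≡ ρ ρ₂ v))
      ... | e , ρ , inj₂ (inj₂ (_ , v)) = there (there (here (row-≡ ρ ρ₃ v)))

mainTheorem14 : (A : ℕ → ℕ → ℕ) → IsTrithoff A →
    -- (1) wall T_{r,0}
    (StrictlyIncr (λ r → leftCol A r 0) ×
     (∀ (v : ℤ) → (Σ ℕ λ r → (1 ≤ r) × (leftCol A r 0 ≡ v)) ⇔
        (Σ ℕ λ n → (1 ≤ n) × (v ≡ + n) × ((tribWord n ≡ just a) ⊎ (tribWord n ≡ just b))))) ×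
    -- (2) seed T_{r,-1}
    (NonDecr (λ r → leftCol A r 1) ×
     (leftCol A 1 1 ≡ + 0) × OccursExactly (λ r → leftCol A r 1) (+ 0) 1 ×
     (∀ n → 1 ≤ n →
        ((tribWord n ≡ just a) → OccursExactly (λ r → leftCol A r 1) (+ n) 2) ×
        ((tribWord n ≢ just a) → OccursExactly (λ r → leftCol A r 1) (+ n) 1))) ×
    -- (3) pre-seed T_{r,-2}
    (NonDecr (λ r → leftCol A r 2) ×
     (leftCol A 1 2 ≡ + 0) × (leftCol A 2 2 ≡ + 0) ×
     OccursExactly (λ r → leftCol A r 2) (+ 0) 2 ×
     (∀ n → 1 ≤ n →
        (((tribWord n ≡ just a) ⊎ (tribWord n ≡ just b)) →
            OccursExactly (λ r → leftCol A r 2) (+ n) 3) ×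
        ((tribWord n ≡ just c) → OccursExactly (λ r → leftCol A r 2) (+ n) 2)))
mainTheorem14 A isT =
  (wall-strictlyIncr , wall-values) ,
  (seed-nonDecr , seed₁ , seed-zero-once , seed-occurrences) ,
  (preseed-nonDecr , preseed₁ , preseed₂ , preseed-zero-twice , preseed-occurrences)
  where open Rows A isT
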